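{- Let $G$ be a graph with $n$ vertices and let $X$ be an array indexed by the subsets of $V(G)$, processed by the following procedure. Initialization: for each $S\subseteq V(G)$, set $X[S]=\chi(S)$ if $\chi(S)\le 3$ and $X[S]=\infty$ otherwise. Main loop: visit the subsets $S$ of $V(G)$ in an order in which every proper subset of a set is visited before the set itself; when $S$ is visited and $3\le X[S]<\infty$, then for each independent set $I$ of $G\setminus S$ produced by a procedure that lists (at least) all maximal independent sets $I$ of $G\setminus S$ with $|I|\le |S|/X[S]$ (and possibly some other, non-maximal, independent sets of $G\setminus S$), set $X[S\cup I]=\min(X[S\cup I],X[S]+1)$. Let $k\ge 0$ be an integer and let $M$ be a maximal $(k+1)$-chromatic subset of $V(G)$. Then, when the main loop reaches $M$, $X[M]=\chi(M)$.
   Context: For $S\subseteq V(G)$, $\chi(S)$ denotes the chromatic number of the subgraph of $G$ induced by $S$. A set $S$ is a maximal $j$-chromatic subset of $T$ if $S\subseteq T$, $\chi(S)=j$, and $\chi(S')>j$ for every $S'$ with $S\subsetneq S'\subseteq T$. An independent set is a set of pairwise nonadjacent vertices; it is maximal in $G\setminus S$ if it is not properly contained in another independent subset of $V(G)\setminus S$. -}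

module Defs where

open import Data.Nat using (ℕ; zero; suc; _≤_; _<_; _*_; _⊓_; _≤?_)
open import Data.Fin using (Fin)
open import Data.Fin.Subset using (Subset; _∈_; _∉_; _⊆_; _⊂_; _∪_; ∁; ∣_∣; ⊤)
open import Data.Bool using (if_then_else_)
import Data.Bool as B
open import Data.Vec.Properties using (≡-dec)
open import Data.Maybe using (Maybe; just; nothing)
open import Data.List using (List; []; _∷_; foldl; _++_)
open import Data.List.Membership.Propositional using () renaming (_∈_ to _∈ˡ_)
open import Data.List.Relation.Unary.Unique.Propositional using (Unique)
open import Data.Product using (Σ; _×_)
open import Relation.Nullary using (¬_; does; yes; no)
open import Relation.Binary.PropositionalEquality using (_≡_; _≢_)

record Graph (n : ℕ) : Set₁ where
  field
    Adj    : Fin n → Fin n → Set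
    sym    : ∀ {u v} → Adj u v → Adj v u
    irrefl : ∀ {u} → ¬ Adj u u
open Graph public

module _ {n : ℕ} (G : Graph n) where

  Colorable : Subset n → ℕ → Set
  Colorable S c = Σ (Fin n → Fin c) λ f →
    ∀ u v → u ∈ S → v ∈ S → Adj G u v → f u ≢ f v

  ChromNum : Subset n → ℕ → Set
  ChromNum S c = Colorable S c × (∀ d → Colorable S d → c ≤ d)

  IndepIn : Subset n → Subset n → Set
  IndepIn S I = (I ⊆ ∁ S) × (∀ u v → u ∈ I → v ∈ I → ¬ Adj G u v)

  MaxIndepIn : Subset n → Subset n → Set
  MaxIndepIn S I = IndepIn S I × (∀ J → IndepIn S J → I ⊆ J → J ⊆ I)

  MaxChromatic : ℕ → Subset n → Set
  MaxChromatic j S = ChromNum S j × (∀ S' c → S ⊂ S' → ChromNum S' c → j < c)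

  -- Initial array: X[S] = χ(S) if χ(S) ≤ 3, ∞ (= nothing) otherwise
  InitOK : (Subset n → Maybe ℕ) → Set
  InitOK X0 = ∀ S c → ChromNum S c →
    (c ≤ 3 → X0 S ≡ just c) × (3 < c → X0 S ≡ nothing)

  -- Listing procedure: given S and the current value x = X[S] (with x ≥ 3),
  -- outputs only independent sets of G \ S, and includes every maximal
  -- independent set I of G \ S with |I| ≤ |S| / x  (i.e. |I| * x ≤ |S|).
  ListingOK : (Subset n → ℕ → List (Subset n)) → Set
  ListingOK L = ∀ S x → 3 ≤ x →
    (∀ I → I ∈ˡ L S x → IndepIn S I) ×
    (∀ I → MaxIndepIn S I → ∣ I ∣ * x ≤ ∣ S ∣ → I ∈ˡ L S x)

  OrderOK : List (Subset n) → Set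
  OrderOK ord = (∀ S → S ∈ˡ ord) × Unique ord ×
    (∀ pre S post → ord ≡ pre ++ (S ∷ post) → ∀ T → T ⊂ S → T ∈ˡ pre)

module _ {n : ℕ} where

  update : (Subset n → Maybe ℕ) → Subset n → Maybe ℕ → (Subset n → Maybe ℕ)
  update X T v U = if does (≡-dec B._≟_ U T) then v else X U

  minInf : Maybe ℕ → ℕ → Maybe ℕ
  minInf nothing  y = just y
  minInf (just a) y = just (a ⊓ y)

  relax : Subset n → ℕ → (Subset n → Maybe ℕ) → Subset n → (Subset n → Maybe ℕ)
  relax S x X I = update X (S ∪ I) (minInf (X (S ∪ I)) (suc x))

  visit : (Subset n → ℕ → List (Subset n)) →
          (Subset n → Maybe ℕ) → Subset n → (Subset n → Maybe ℕ)
  visit L X S with X S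
  ... | nothing = X
  ... | just x with 3 ≤? x
  ...   | yes _ = foldl (relax S x) X (L S x)
  ...   | no  _ = X

  runLoop : (Subset n → ℕ → List (Subset n)) →
            (Subset n → Maybe ℕ) → List (Subset n) → (Subset n → Maybe ℕ)
  runLoop L = foldl (visit L)

{-# OPTIONS --safe #-}
-- Every finite entry X[T] = x is witnessed by an x-colouring of T (initially through χ(T);
-- a relaxation colours S ∪ I by giving the independent set I one new colour), and entries
-- never increase.  Hence it suffices to see X[M] ≤ χ(M) = k + 1, which for k + 1 ≤ 3 is the
-- initialisation.  Otherwise pick an independent I ⊆ M of least size such that M ∖ I is
-- k-colourable and put S = M ∖ I.  Minimality of I and maximality of M make S maximal
-- k-chromatic and I maximal independent in G ∖ S; since every colour class of S could replace
-- I, |I| · k ≤ |S|.  By induction X[S] = k when S is visited, which happens before M, so I is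
-- listed and X[M] = X[S ∪ I] drops to k + 1.  The minimal I and χ(T) exist only classically,
-- so they are used under ¬ ¬, which is harmless as the goal X[M] ≡ just χ(M) is decidable.
module Submission where

open import Defs hiding (sym)
open import Level using (0ℓ)
open import Data.Empty using (⊥; ⊥-elim)
import Data.Bool as B
open import Data.Bool.Properties using (T-≡)
open import Data.Nat.Base using (ℕ; zero; suc; _+_; _*_; _≤_; _<_; _≡ᵇ_; z≤n; s≤s; s≤s⁻¹)
open import Data.Nat.Properties
  using (_≤?_; _<?_; ≡ᵇ⇒≡; ≡⇒≡ᵇ; ≤-refl; ≤-trans; ≤-antisym; +-suc; +-mono-≤; *-zeroʳ; *-suc; n<1+n; n≤1+n;
         ≮⇒≥; ≰⇒>; <⇒≢; <⇒≱; ≤∧≢⇒<; m<n⇒m<1+n; 1+n≰n; ⊓-sel; m⊓n≤m; m⊓n≤n; module ≤-Reasoning)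
import Data.Nat.Properties as ℕ
open import Data.Nat.Induction using (<-wellFounded)
open import Induction.WellFounded using (Acc; acc)
open import Data.Fin.Base using (Fin; toℕ; fromℕ; fromℕ<; inject≤; pinch)
import Data.Fin.Base as Fin
open import Data.Fin.Properties
  using (toℕ-injective; toℕ<n; toℕ-fromℕ; toℕ-fromℕ<; toℕ-inject≤; inject≤-injective; pinch-injective)
import Data.Fin.Properties as Fin
open import Data.Fin.Subset hiding (⊥)
open import Data.Fin.Subset.Properties
open import Data.Maybe.Base using (Maybe; just; nothing)
open import Data.Maybe.Properties using (just-injective)
import Data.Maybe.Properties as Maybe
open import Data.Vec.Base using (_∷_; []; tabulate; here; there)
open import Data.Vec.Properties using (lookup∘tabulate; lookup⇒[]=; []=⇒lookup; ≡-dec)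
open import Data.List.Base using (List; _∷_; []; _++_; foldl)
open import Data.List.Properties using (++-assoc; foldl-++)
open import Data.List.Membership.Propositional using () renaming (_∈_ to _∈ˡ_)
open import Data.List.Membership.Propositional.Properties using (∈-∃++)
import Data.List.Relation.Unary.Any as Any
open import Data.Product.Base using (∃; ∃₂; _×_; _,_; proj₁; proj₂)
open import Data.Sum.Base using (_⊎_; inj₁; inj₂; [_,_]′)
import Data.Sum.Base as Sum
open import Function.Base using (_∘_; id)
open import Function.Bundles using (Equivalence)
open import Relation.Nullary using (¬_; yes; no)
open import Relation.Nullary.Decidable using (dec-true; decidable-stable; ¬¬-excluded-middle)
open import Relation.Nullary.Negation using (¬¬-Monad; ¬¬-map; contradiction)
open import Relation.Binary.PropositionalEquality
  using (_≡_; _≢_; refl; sym; trans; cong; subst; module ≡-Reasoning)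
open import Effect.Monad using (RawMonad)

open RawMonad (¬¬-Monad {0ℓ}) using (return; _>>=_)

private
  variable
    n c d k x y : ℕ
    m : Maybe ℕ

¬¬-minimal : {A : Set} {P : A → Set} (μ : A → ℕ) {a : A} → P a →
             ¬ ¬ (∃ λ a → P a × ∀ b → P b → μ a ≤ μ b)
¬¬-minimal {A} {P} μ {a} pa = go (<-wellFounded (μ a)) pa
  where
  go : ∀ {a} → Acc _<_ (μ a) → P a → ¬ ¬ (∃ λ a → P a × ∀ b → P b → μ a ≤ μ b)
  go {a} (acc smaller) pa = do
    yes (b , pb , b<a) ← ¬¬-excluded-middle {A = ∃ λ b → P b × μ b < μ a}
      where no none → return (a , pa , λ b pb → ≮⇒≥ (λ b<a → none (b , pb , b<a)))
    go (smaller b<a) pb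

foldl-preserves : {A B : Set} (P : A → Set) (f : A → B → A) (xs : List B) →
                  (∀ {a b} → b ∈ˡ xs → P a → P (f a b)) → ∀ {a} → P a → P (foldl f a xs)
foldl-preserves P f []       step pa = pa
foldl-preserves P f (x ∷ xs) step pa = foldl-preserves P f xs (step ∘ Any.there) (step (Any.here refl) pa)

x∈p─q⇒x∉q : ∀ {x : Fin n} (p q : Subset n) → x ∈ p ─ q → x ∉ q
x∈p─q⇒x∉q (_ ∷ p) (outside ∷ q) (there x∈p─q) (there x∈q) = x∈p─q⇒x∉q p q x∈p─q x∈q
x∈p─q⇒x∉q (_ ∷ p) (inside  ∷ q) (there x∈p─q) (there x∈q) = x∈p─q⇒x∉q p q x∈p─q x∈q

p─q∪q≡p : ∀ {p q : Subset n} → q ⊆ p → (p ─ q) ∪ q ≡ p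
p─q∪q≡p {p = p} {q} q⊆p = ⊆-antisym (λ x∈ → [ p─q⊆p p q , q⊆p ]′ (x∈p∪q⁻ (p ─ q) q x∈)) p⊆p─q∪q
  where
  p⊆p─q∪q : p ⊆ (p ─ q) ∪ q
  p⊆p─q∪q {x} x∈p with x ∈? q
  ... | yes x∈q = x∈p∪q⁺ (inj₂ x∈q)
  ... | no  x∉q = x∈p∪q⁺ (inj₁ (x∈p∧x∉q⇒x∈p─q x∈p x∉q))

∪-mono-⊆ : ∀ {p p′ q q′ : Subset n} → p ⊆ p′ → q ⊆ q′ → p ∪ q ⊆ p′ ∪ q′
∪-mono-⊆ {p = p} {q = q} p⊆p′ q⊆q′ x∈ = x∈p∪q⁺ (Sum.map p⊆p′ q⊆q′ (x∈p∪q⁻ p q x∈))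

∣p∩q∣+∣p─q∣≡∣p∣ : ∀ (p q : Subset n) → ∣ p ∩ q ∣ + ∣ p ─ q ∣ ≡ ∣ p ∣
∣p∩q∣+∣p─q∣≡∣p∣ []            []            = refl
∣p∩q∣+∣p─q∣≡∣p∣ (inside  ∷ p) (inside  ∷ q) = cong suc (∣p∩q∣+∣p─q∣≡∣p∣ p q)
∣p∩q∣+∣p─q∣≡∣p∣ (inside  ∷ p) (outside ∷ q) = trans (+-suc ∣ p ∩ q ∣ ∣ p ─ q ∣) (cong suc (∣p∩q∣+∣p─q∣≡∣p∣ p q))
∣p∩q∣+∣p─q∣≡∣p∣ (outside ∷ p) (inside  ∷ q) = ∣p∩q∣+∣p─q∣≡∣p∣ p q
∣p∩q∣+∣p─q∣≡∣p∣ (outside ∷ p) (outside ∷ q) = ∣p∩q∣+∣p─q∣≡∣p∣ p q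

fibre : (Fin n → ℕ) → ℕ → Subset n
fibre g j = tabulate (λ x → g x ≡ᵇ j)

x∈fibre⁺ : ∀ (g : Fin n → ℕ) {j x} → g x ≡ j → x ∈ fibre g j
x∈fibre⁺ g {j} {x} gx≡j =
  lookup⇒[]= x (fibre g j) (trans (lookup∘tabulate _ x) (Equivalence.to T-≡ (≡⇒≡ᵇ (g x) j gx≡j)))

x∈fibre⁻ : ∀ (g : Fin n → ℕ) {j x} → x ∈ fibre g j → g x ≡ j
x∈fibre⁻ g {j} {x} x∈ =
  ≡ᵇ⇒≡ (g x) j (Equivalence.from T-≡ (trans (sym (lookup∘tabulate _ x)) ([]=⇒lookup x∈)))

fibres-size : ∀ (g : Fin n → ℕ) k {b} (S : Subset n) → (∀ {x} → x ∈ S → g x < k) →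
              (∀ {j} → j < k → b ≤ ∣ S ∩ fibre g j ∣) → b * k ≤ ∣ S ∣
fibres-size g zero    {b} S bounded large rewrite *-zeroʳ b = z≤n
fibres-size g (suc k) {b} S bounded large = begin
  b * suc k                  ≡⟨ *-suc b k ⟩
  b + b * k                  ≤⟨ +-mono-≤ (large (n<1+n k)) (fibres-size g k S′ bounded′ large′) ⟩
  ∣ S ∩ fibre g k ∣ + ∣ S′ ∣  ≡⟨ ∣p∩q∣+∣p─q∣≡∣p∣ S (fibre g k) ⟩
  ∣ S ∣                      ∎
  where
  open ≤-Reasoning
  S′ = S ─ fibre g k
  bounded′ : ∀ {x} → x ∈ S′ → g x < k
  bounded′ x∈S′ = ≤∧≢⇒< (s≤s⁻¹ (bounded (p─q⊆p S _ x∈S′))) (x∈p─q⇒x∉q S _ x∈S′ ∘ x∈fibre⁺ g)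
  large′ : ∀ {j} → j < k → b ≤ ∣ S′ ∩ fibre g j ∣
  large′ {j} j<k = ≤-trans (large (m<n⇒m<1+n j<k)) (p⊆q⇒∣p∣≤∣q∣ S∩j⊆S′∩j)
    where
    S∩j⊆S′∩j : S ∩ fibre g j ⊆ S′ ∩ fibre g j
    S∩j⊆S′∩j x∈ with x∈p∩q⁻ S (fibre g j) x∈
    ... | x∈S , x∈j = x∈p∩q⁺ (x∈p∧x∉q⇒x∈p─q x∈S (λ x∈k → <⇒≢ j<k (trans (sym (x∈fibre⁻ g x∈j)) (x∈fibre⁻ g x∈k))) , x∈j)

colourClass : (Fin n → Fin c) → Fin c → Subset n
colourClass f j = fibre (toℕ ∘ f) (toℕ j)

x∈colourClass⁺ : ∀ (f : Fin n → Fin c) {j x} → f x ≡ j → x ∈ colourClass f j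
x∈colourClass⁺ f fx≡j = x∈fibre⁺ (toℕ ∘ f) (cong toℕ fx≡j)

x∈colourClass⁻ : ∀ (f : Fin n → Fin c) {j x} → x ∈ colourClass f j → f x ≡ j
x∈colourClass⁻ f x∈ = toℕ-injective (x∈fibre⁻ (toℕ ∘ f) x∈)

colourClasses-size : ∀ {b} (f : Fin n → Fin k) S → (∀ j → b ≤ ∣ S ∩ colourClass f j ∣) → b * k ≤ ∣ S ∣
colourClasses-size {k = k} {b} f S large = fibres-size (toℕ ∘ f) k S (λ {x} _ → toℕ<n (f x)) λ j<k →
  subst (λ i → b ≤ ∣ S ∩ fibre (toℕ ∘ f) i ∣) (toℕ-fromℕ< j<k) (large (fromℕ< j<k))

module _ (G : Graph n) where

  private
    variable
      S T I : Subset n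

  Independent : Subset n → Set
  Independent I = ∀ u v → u ∈ I → v ∈ I → ¬ Adj G u v

  Colorable-⊆ : T ⊆ S → Colorable G S c → Colorable G T c
  Colorable-⊆ T⊆S (f , proper) = f , λ u v u∈T v∈T → proper u v (T⊆S u∈T) (T⊆S v∈T)

  Colorable-≤ : c ≤ d → Colorable G S c → Colorable G S d
  Colorable-≤ c≤d (f , proper) =
    (λ u → inject≤ (f u) c≤d) , λ u v u∈S v∈S adj → proper u v u∈S v∈S adj ∘ inject≤-injective c≤d c≤d _ _

  Colorable-n : Colorable G S n
  Colorable-n = id , λ u v _ _ adj u≡v → irrefl G (subst (Adj G u) (sym u≡v) adj)

  ¬¬-chromaticNumber : ∀ S → ¬ ¬ ∃ (ChromNum G S)
  ¬¬-chromaticNumber S = ¬¬-minimal id (Colorable-n {S})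

  ChromNum-unique : ChromNum G S c → ChromNum G S d → c ≡ d
  ChromNum-unique (colc , leastc) (cold , leastd) = ≤-antisym (leastc _ cold) (leastd _ colc)

  MaxChromatic⇒⊃-¬Colorable : ∀ {j M} → MaxChromatic G j M → M ⊂ T → ¬ Colorable G T j
  MaxChromatic⇒⊃-¬Colorable {T = T} (_ , maximal) M⊂T col =
    ¬¬-chromaticNumber T λ (c , χT) → <⇒≱ (maximal T c M⊂T χT) (proj₂ χT _ col)

  colourClass-independent : ∀ (col : Colorable G S c) j → Independent (S ∩ colourClass (proj₁ col) j)
  colourClass-independent {S = S} (f , proper) j u v u∈ v∈ adj =
    proper u v (p∩q⊆p S _ u∈) (p∩q⊆p S _ v∈) adj
      (trans (x∈colourClass⁻ f (p∩q⊆q S _ u∈)) (sym (x∈colourClass⁻ f (p∩q⊆q S _ v∈))))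

  -- I is painted with colour j, whose old class has been removed.
  repaint : ∀ (col : Colorable G S c) → Independent I → ∀ j →
            Colorable G (I ∪ (S ─ colourClass (proj₁ col) j)) c
  repaint {S = S} {c = c} {I = I} (f , proper) indep j = f′ , proper′
    where
    C = colourClass f j
    f′ : Fin n → Fin c
    f′ u with u ∈? I
    ... | yes _ = j
    ... | no  _ = f u
    unpainted : ∀ {u} → u ∈ I ∪ (S ─ C) → u ∉ I → u ∈ S ─ C
    unpainted {u} u∈ u∉I with x∈p∪q⁻ I (S ─ C) u∈
    ... | inj₁ u∈I   = ⊥-elim (u∉I u∈I)
    ... | inj₂ u∈S─C = u∈S─C
    proper′ : ∀ u v → u ∈ I ∪ (S ─ C) → v ∈ I ∪ (S ─ C) → Adj G u v → f′ u ≢ f′ v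
    proper′ u v u∈ v∈ adj with u ∈? I | v ∈? I
    ... | yes u∈I | yes v∈I = ⊥-elim (indep u v u∈I v∈I adj)
    ... | yes _   | no  v∉I = λ j≡fv → x∈p─q⇒x∉q S C (unpainted v∈ v∉I) (x∈colourClass⁺ f (sym j≡fv))
    ... | no  u∉I | yes _   = λ fu≡j → x∈p─q⇒x∉q S C (unpainted u∈ u∉I) (x∈colourClass⁺ f fu≡j)
    ... | no  u∉I | no  v∉I = proper u v (p─q⊆p S C (unpainted u∈ u∉I)) (p─q⊆p S C (unpainted v∈ v∉I)) adj

  Colorable-∪ : Colorable G S c → Independent I → Colorable G (S ∪ I) (suc c)
  Colorable-∪ {S = S} {c = c} {I = I} col indep = Colorable-⊆ cover (repaint col′ indep (fromℕ c))
    where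
    f = proj₁ col
    col′ = Colorable-≤ (n≤1+n c) col
    cover : S ∪ I ⊆ I ∪ (S ─ colourClass (proj₁ col′) (fromℕ c))
    cover {x} x∈ with x ∈? I | x∈p∪q⁻ S I x∈
    ... | yes x∈I | _        = x∈p∪q⁺ (inj₁ x∈I)
    ... | no  x∉I | inj₂ x∈I = ⊥-elim (x∉I x∈I)
    ... | no  _   | inj₁ x∈S = x∈p∪q⁺ (inj₂ (x∈p∧x∉q⇒x∈p─q x∈S unused))
      where
      open ≡-Reasoning
      unused : x ∉ colourClass (proj₁ col′) (fromℕ c)
      unused x∈C = <⇒≢ (toℕ<n (f x)) (begin
        toℕ (f x)           ≡⟨ toℕ-inject≤ (f x) (n≤1+n c) ⟨
        toℕ (proj₁ col′ x)  ≡⟨ x∈fibre⁻ (toℕ ∘ proj₁ col′) x∈C ⟩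
        toℕ (fromℕ c)       ≡⟨ toℕ-fromℕ c ⟩
        c                   ∎)

  -- pinch 0F merges colour 1F into 0F, which is harmless once class 1F is gone.
  Colorable-─colourClass : ∀ (col : Colorable G S (suc (suc c))) →
                           Colorable G (S ─ colourClass (proj₁ col) (Fin.suc Fin.zero)) (suc c)
  Colorable-─colourClass {S = S} (f , proper) = pinch Fin.zero ∘ f , λ u v u∈ v∈ adj →
    proper u v (p─q⊆p S C u∈) (p─q⊆p S C v∈) adj ∘ pinch-injective (not1 u∈) (not1 v∈)
    where
    C = colourClass f (Fin.suc Fin.zero)
    not1 : ∀ {u} → u ∈ S ─ C → Fin.suc Fin.zero ≢ f u
    not1 u∈ 1≡fu = x∈p─q⇒x∉q S C u∈ (x∈colourClass⁺ f (sym 1≡fu))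

record Split (G : Graph n) (k : ℕ) (M : Subset n) : Set where
  field
    S I            : Subset n
    S∪I≡M          : S ∪ I ≡ M
    S⊂M            : S ⊂ M
    S-maxChromatic : MaxChromatic G k S
    I-maxIndep     : MaxIndepIn G S I
    I-small        : ∣ I ∣ * k ≤ ∣ S ∣

module _ (G : Graph n) {M : Subset n} (M-max : MaxChromatic G (suc (suc k)) M) where

  record Candidate (I : Subset n) : Set where
    constructor candidate
    field
      ⊆M          : I ⊆ M
      independent : Independent G I
      colourable  : Colorable G (M ─ I) (suc k)

  initial-candidate : ∃ Candidate
  initial-candidate = M ∩ C , candidate (p∩q⊆p M C) (colourClass-independent G col (Fin.suc Fin.zero))
                                        (Colorable-⊆ G M─M∩C⊆M─C (Colorable-─colourClass G col))
    where
    col = proj₁ (proj₁ M-max)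
    C = colourClass (proj₁ col) (Fin.suc Fin.zero)
    M─M∩C⊆M─C : M ─ M ∩ C ⊆ M ─ C
    M─M∩C⊆M─C x∈ = x∈p∧x∉q⇒x∈p─q (p─q⊆p M _ x∈) (λ x∈C → x∈p─q⇒x∉q M _ x∈ (x∈p∩q⁺ (p─q⊆p M _ x∈ , x∈C)))

  module Minimal {I} (cand : Candidate I) (minimal : ∀ J → Candidate J → ∣ I ∣ ≤ ∣ J ∣) where

    open Candidate cand renaming (⊆M to I⊆M; independent to indep; colourable to colS)

    S : Subset n
    S = M ─ I

    M⊆S∪I : M ⊆ S ∪ I
    M⊆S∪I = ⊆-reflexive (sym (p─q∪q≡p I⊆M))

    x∈M∧x∉I⇒x∈S : ∀ {x} → x ∈ M → x ∉ I → x ∈ S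
    x∈M∧x∉I⇒x∈S = x∈p∧x∉q⇒x∈p─q

    -- T ∪ J would be a (k+2)-colourable proper superset of M.
    M-unextendable : ∀ {T J v} → Colorable G T (suc k) → Independent G J → S ⊆ T → I ⊆ J →
                     v ∈ T ∪ J → v ∉ M → ⊥
    M-unextendable colT indepJ S⊆T I⊆J v∈ v∉M = MaxChromatic⇒⊃-¬Colorable G M-max
      ((∪-mono-⊆ S⊆T I⊆J ∘ M⊆S∪I) , _ , v∈ , v∉M) (Colorable-∪ G colT indepJ)

    I-tight : ∀ {v} → v ∈ I → ¬ Colorable G (M ─ (I - v)) (suc k)
    I-tight {v} v∈I col = <⇒≱ (x∈p⇒∣p-x∣<∣p∣ v∈I) (minimal (I - v)
      (candidate (I⊆M ∘ p─q⊆p I _) (λ u w u∈ w∈ → indep u w (p─q⊆p I _ u∈) (p─q⊆p I _ w∈)) col))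

    I-nonempty : Nonempty I
    I-nonempty with nonempty? I
    ... | yes ne = ne
    ... | no  empty = ⊥-elim (1+n≰n (proj₂ (proj₁ M-max) (suc k) (Colorable-⊆ G M⊆S colS)))
      where
      M⊆S : M ⊆ S
      M⊆S x∈M = x∈M∧x∉I⇒x∈S x∈M (λ x∈I → empty (_ , x∈I))

    S⊂M : S ⊂ M
    S⊂M with I-nonempty
    ... | v , v∈I = p─q⊆p M I , v , I⊆M v∈I , λ v∈S → x∈p─q⇒x∉q M I v∈S v∈I

    S-chromatic : ChromNum G S (suc k)
    S-chromatic = colS , λ d col →
      s≤s⁻¹ (proj₂ (proj₁ M-max) (suc d) (Colorable-⊆ G M⊆S∪I (Colorable-∪ G col indep)))

    S-maximal : ∀ S′ c → S ⊂ S′ → ChromNum G S′ c → suc k < c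
    S-maximal S′ c (S⊆S′ , v , v∈S′ , v∉S) (colS′ , _) with suc k <? c
    ... | yes k<c = k<c
    ... | no  k≮c with v ∈? M | v ∈? I
    ...   | no  v∉M | _       = ⊥-elim (M-unextendable col′ indep S⊆S′ id (x∈p∪q⁺ (inj₁ v∈S′)) v∉M)
      where col′ = Colorable-≤ G (≮⇒≥ k≮c) colS′
    ...   | yes v∈M | no  v∉I = ⊥-elim (v∉S (x∈M∧x∉I⇒x∈S v∈M v∉I))
    ...   | yes _   | yes v∈I = ⊥-elim (I-tight v∈I (Colorable-⊆ G into (Colorable-≤ G (≮⇒≥ k≮c) colS′)))
      where
      into : M ─ (I - v) ⊆ S′
      into {x} x∈ with x Fin.≟ v | x ∈? I
      ... | yes refl | _       = v∈S′
      ... | no  x≢v  | yes x∈I = ⊥-elim (x∈p─q⇒x∉q M _ x∈ (x∈p∧x≢y⇒x∈p-y x∈I x≢v))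
      ... | no  _    | no  x∉I = S⊆S′ (x∈M∧x∉I⇒x∈S (p─q⊆p M _ x∈) x∉I)

    I-maximal : MaxIndepIn G S I
    I-maximal = (I⊆∁S , indep) , λ J (J⊆∁S , indepJ) I⊆J {u} → J⊆I u J⊆∁S indepJ I⊆J
      where
      I⊆∁S : I ⊆ ∁ S
      I⊆∁S x∈I = x∉p⇒x∈∁p (λ x∈S → x∈p─q⇒x∉q M I x∈S x∈I)
      J⊆I : ∀ u {J} → J ⊆ ∁ S → Independent G J → I ⊆ J → u ∈ J → u ∈ I
      J⊆I u J⊆∁S indepJ I⊆J u∈J with u ∈? I
      ... | yes u∈I = u∈I
      ... | no  u∉I = ⊥-elim (M-unextendable colS indepJ id I⊆J (x∈p∪q⁺ (inj₂ u∈J))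
                        λ u∈M → x∈∁p⇒x∉p (J⊆∁S u∈J) (x∈M∧x∉I⇒x∈S u∈M u∉I))

    -- Each colour class D of S is a candidate (I takes over D's colour), so |I| ≤ |D|.
    I-small : ∣ I ∣ * suc k ≤ ∣ S ∣
    I-small = colourClasses-size (proj₁ colS) S λ j → minimal _ (class-candidate j)
      where
      class-candidate : ∀ j → Candidate (S ∩ colourClass (proj₁ colS) j)
      class-candidate j = candidate (p─q⊆p M I ∘ p∩q⊆p S _) (colourClass-independent G colS j)
                                    (Colorable-⊆ G cover (repaint G colS indep j))
        where
        C = colourClass (proj₁ colS) j
        cover : M ─ S ∩ C ⊆ I ∪ (S ─ C)
        cover {x} x∈ with x ∈? I
        ... | yes x∈I = x∈p∪q⁺ (inj₁ x∈I)
        ... | no  x∉I = x∈p∪q⁺ (inj₂ (x∈p∧x∉q⇒x∈p─q x∈S λ x∈C → x∈p─q⇒x∉q M _ x∈ (x∈p∩q⁺ (x∈S , x∈C))))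
          where x∈S = x∈M∧x∉I⇒x∈S (p─q⊆p M _ x∈) x∉I

    split : Split G (suc k) M
    split = record
      { S = S ; I = I ; S∪I≡M = p─q∪q≡p I⊆M ; S⊂M = S⊂M
      ; S-maxChromatic = S-chromatic , S-maximal ; I-maxIndep = I-maximal ; I-small = I-small }

  ¬¬-split : ¬ ¬ Split G (suc k) M
  ¬¬-split = do
    (I , cand , minimal) ← ¬¬-minimal ∣_∣ (proj₂ initial-candidate)
    return (Minimal.split cand minimal)

infix 4 _≤∞_ _≼_

data _≤∞_ : Maybe ℕ → Maybe ℕ → Set where
  just≤just : x ≤ y → just x ≤∞ just y
  ≤nothing  : m ≤∞ nothing

≤∞-refl : m ≤∞ m
≤∞-refl {just x}  = just≤just ≤-refl
≤∞-refl {nothing} = ≤nothing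

≤∞-trans : ∀ {m₁ m₂ m₃} → m₁ ≤∞ m₂ → m₂ ≤∞ m₃ → m₁ ≤∞ m₃
≤∞-trans (just≤just x≤y) (just≤just y≤z) = just≤just (≤-trans x≤y y≤z)
≤∞-trans _               ≤nothing        = ≤nothing

≤∞-just⁻ : m ≤∞ just y → ∃ λ x → m ≡ just x × x ≤ y
≤∞-just⁻ (just≤just x≤y) = _ , refl , x≤y

-- minInf has an implicit n that it never uses, so n cannot be inferred and is passed explicitly.
minInf-≤ˡ : minInf {n} m y ≤∞ m
minInf-≤ˡ {m = just x} {y = y} = just≤just (m⊓n≤m x y)
minInf-≤ˡ {m = nothing}        = ≤nothing

minInf-≤ʳ : minInf {n} m y ≤∞ just y
minInf-≤ʳ {m = just x} {y = y} = just≤just (m⊓n≤n x y)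
minInf-≤ʳ {m = nothing}        = ≤∞-refl

minInf-sel : minInf {n} m y ≡ just x → m ≡ just x ⊎ y ≡ x
minInf-sel {m = nothing}        refl = inj₂ refl
minInf-sel {m = just x} {y = y} refl with ⊓-sel x y
... | inj₁ x⊓y≡x = inj₁ (cong just (sym x⊓y≡x))
... | inj₂ x⊓y≡y = inj₂ (sym x⊓y≡y)

Table : ℕ → Set
Table n = Subset n → Maybe ℕ

_≼_ : Table n → Table n → Set
X ≼ Y = ∀ T → X T ≤∞ Y T

≼-refl : ∀ {X : Table n} → X ≼ X
≼-refl T = ≤∞-refl

≼-trans : ∀ {X Y Z : Table n} → X ≼ Y → Y ≼ Z → X ≼ Z
≼-trans X≼Y Y≼Z T = ≤∞-trans (X≼Y T) (Y≼Z T)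

foldl-≼ : ∀ {B : Set} (f : Table n → B → Table n) → (∀ X b → f X b ≼ X) → ∀ X bs → foldl f X bs ≼ X
foldl-≼ f step X bs = foldl-preserves (_≼ X) f bs (λ _ Y≼X → ≼-trans (step _ _) Y≼X) ≼-refl

update-≼ : ∀ {X : Table n} {T v} → v ≤∞ X T → update X T v ≼ X
update-≼ {T = T} v≤XT U with ≡-dec B._≟_ U T
... | yes refl = v≤XT
... | no  _    = ≤∞-refl

relax-≼ : ∀ (S : Subset n) x X I → relax S x X I ≼ X
relax-≼ {n} S x X I = update-≼ (minInf-≤ˡ {n})

relax-at : ∀ (S : Subset n) x X I → relax S x X I (S ∪ I) ≤∞ just (suc x)
relax-at {n} S x X I rewrite dec-true (≡-dec B._≟_ (S ∪ I) (S ∪ I)) refl = minInf-≤ʳ {n}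

relaxAll-at : ∀ {S : Subset n} {x X I Is} → I ∈ˡ Is → foldl (relax S x) X Is (S ∪ I) ≤∞ just (suc x)
relaxAll-at {S = S} {x} {X} {I} {_ ∷ Is} (Any.here refl) =
  ≤∞-trans (foldl-≼ (relax S x) (relax-≼ S x) _ Is (S ∪ I)) (relax-at S x X I)
relaxAll-at (Any.there I∈Is) = relaxAll-at I∈Is

module Loop (L : Subset n → ℕ → List (Subset n)) where

  visit-≼ : ∀ X S → visit L X S ≼ X
  visit-≼ X S with X S
  ... | nothing = ≼-refl
  ... | just x with 3 ≤? x
  ...   | yes _ = foldl-≼ (relax S x) (relax-≼ S x) X (L S x)
  ...   | no  _ = ≼-refl

  visit-at : ∀ {X S x} → X S ≡ just x → 3 ≤ x → visit L X S ≡ foldl (relax S x) X (L S x)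
  visit-at {X} {S} XS≡x 3≤x with X S
  visit-at {x = x} refl 3≤x | just .x with 3 ≤? x
  ... | yes _   = refl
  ... | no  3≰x = contradiction 3≤x 3≰x

  runLoop-≼ : ∀ X ps → runLoop L X ps ≼ X
  runLoop-≼ = foldl-≼ (visit L) visit-≼

  module Soundness (G : Graph n) (listing : ListingOK G L) where

    Sound : Table n → Set
    Sound X = ∀ T x → X T ≡ just x → ¬ ¬ Colorable G T x

    relax-sound : ∀ {S x X I} → Sound X → ¬ ¬ Colorable G S x → Independent G I → Sound (relax S x X I)
    relax-sound {S} {x} {X} {I} sound colS indep T y XT≡y with ≡-dec B._≟_ T (S ∪ I)
    ... | no  _    = sound T y XT≡y
    ... | yes refl = [ sound T y , (λ { refl → ¬¬-map (λ col → Colorable-∪ G col indep) colS }) ]′ (minInf-sel {n} XT≡y)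

    visit-sound : ∀ {X} S → Sound X → Sound (visit L X S)
    visit-sound {X} S sound with X S in XS≡x
    ... | nothing = sound
    ... | just x with 3 ≤? x
    ...   | no  _   = sound
    ...   | yes 3≤x = foldl-preserves Sound (relax S x) (L S x)
                        (λ I∈ soundY → relax-sound soundY (sound S x XS≡x) (proj₂ (proj₁ (listing S x 3≤x) _ I∈)))
                        sound

    runLoop-sound : ∀ {X} ps → Sound X → Sound (runLoop L X ps)
    runLoop-sound ps = foldl-preserves Sound (visit L) ps (λ {_} {S} _ → visit-sound S)

    initial-sound : ∀ {X₀} → InitOK G X₀ → Sound X₀
    initial-sound {X₀} init T x X₀T≡x = ¬¬-map colourable (¬¬-chromaticNumber G T)
      where
      colourable : ∃ (ChromNum G T) → Colorable G T x
      colourable (c , χT) with c ≤? 3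
      ... | yes c≤3 = subst (Colorable G T) (just-injective (trans (sym (proj₁ (init T c χT) c≤3)) X₀T≡x)) (proj₁ χT)
      ... | no  c≰3 with () ← trans (sym X₀T≡x) (proj₂ (init T c χT) (≰⇒> c≰3))

    tight : ∀ {X T c} → Sound X → ChromNum G T c → ¬ ¬ (X T ≤∞ just c) → X T ≡ just c
    tight {X} {T} {c} sound (_ , least) bound = decidable-stable (Maybe.≡-dec ℕ._≟_ (X T) (just c)) do
      (b , XT≡b , b≤c) ← ¬¬-map ≤∞-just⁻ bound
      colourable ← sound T b XT≡b
      return (trans XT≡b (cong just (≤-antisym b≤c (least b colourable))))

module Run (G : Graph n) (X₀ : Table n) (L : Subset n → ℕ → List (Subset n)) (ord : List (Subset n))
           (init : InitOK G X₀) (listing : ListingOK G L) (order : OrderOK G ord) where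

  open Loop L
  open Soundness G listing

  visited-before : ∀ {S M} pre {post} → ord ≡ pre ++ M ∷ post → S ⊂ M → ∃₂ λ pre₁ pre₂ → pre ≡ pre₁ ++ S ∷ pre₂
  visited-before pre ord≡ S⊂M = ∈-∃++ (proj₂ (proj₂ order) pre _ _ ord≡ _ S⊂M)

  initial-bound : ∀ {M c} pre → ChromNum G M c → c ≤ 3 → runLoop L X₀ pre M ≤∞ just c
  initial-bound {M} pre χM c≤3 = subst (runLoop L X₀ pre M ≤∞_) (proj₁ (init M _ χM) c≤3) (runLoop-≼ X₀ pre M)

  split-bound : ∀ {k M} pre {post} → 3 ≤ k → ord ≡ pre ++ M ∷ post →
                (∀ {S} pre′ {post′} → MaxChromatic G k S → ord ≡ pre′ ++ S ∷ post′ → runLoop L X₀ pre′ S ≡ just k) →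
                Split G k M → runLoop L X₀ pre M ≤∞ just (suc k)
  split-bound {k} {M} pre {post} 3≤k ord≡ exact sp with visited-before pre ord≡ (Split.S⊂M sp)
  ... | pre₁ , pre₂ , refl =
    subst (λ Y → Y M ≤∞ just (suc k)) (sym (foldl-++ (visit L) X₀ pre₁ (S ∷ pre₂)))
      (≤∞-trans (runLoop-≼ (visit L X₁ S) pre₂ M) (subst (λ T → visit L X₁ S T ≤∞ just (suc k)) S∪I≡M visited))
    where
    open Split sp
    X₁ = runLoop L X₀ pre₁
    visited : visit L X₁ S (S ∪ I) ≤∞ just (suc k)
    visited = subst (λ Y → Y (S ∪ I) ≤∞ just (suc k))
                (sym (visit-at {X = X₁} (exact pre₁ S-maxChromatic (trans ord≡ (++-assoc pre₁ (S ∷ pre₂) (M ∷ post)))) 3≤k))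
                (relaxAll-at (proj₂ (listing S k 3≤k) I I-maxIndep I-small))

  loop-exact : ∀ k {M} pre {post} → MaxChromatic G (suc k) M → ord ≡ pre ++ M ∷ post → runLoop L X₀ pre M ≡ just (suc k)
  loop-bound : ∀ k {M} pre {post} → MaxChromatic G (suc k) M → ord ≡ pre ++ M ∷ post → ¬ ¬ (runLoop L X₀ pre M ≤∞ just (suc k))

  loop-exact k pre M-max ord≡ = tight (runLoop-sound pre (initial-sound init)) (proj₁ M-max) (loop-bound k pre M-max ord≡)

  loop-bound 0 pre M-max _ = return (initial-bound pre (proj₁ M-max) (s≤s z≤n))
  loop-bound 1 pre M-max _ = return (initial-bound pre (proj₁ M-max) (s≤s (s≤s z≤n)))
  loop-bound 2 pre M-max _ = return (initial-bound pre (proj₁ M-max) (s≤s (s≤s (s≤s z≤n))))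
  loop-bound (suc (suc (suc k))) pre M-max ord≡ =
    ¬¬-map (split-bound pre (s≤s (s≤s (s≤s z≤n))) ord≡ (loop-exact (suc (suc k)))) (¬¬-split G M-max)

lemma5 : ∀ {n} (G : Graph n) (X0 : Subset n → Maybe ℕ) (L : Subset n → ℕ → List (Subset n))
           (ord : List (Subset n)) →
           InitOK G X0 → ListingOK G L → OrderOK G ord →
           (k : ℕ) (M : Subset n) → MaxChromatic G (suc k) M →
           ∀ pre post → ord ≡ pre ++ (M ∷ post) →
           ∀ c → ChromNum G M c → runLoop L X0 pre M ≡ just c
lemma5 G X0 L ord init listing order k M M-max pre post ord≡ c χM =
  trans (Run.loop-exact G X0 L ord init listing order k pre M-max ord≡)
        (cong just (ChromNum-unique G (proj₁ M-max) χM))
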